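{- Let $q$ be a prime power, $s\ge2$, the bases $\mathfrak{B}_{m,i}$ be as in the context, and let $\boldsymbol{\alpha}=(\alpha_1,\ldots,\alpha_s)\in Y^s$ with $\alpha_i=\sum_{j\ge0}a_{i,j}x^j$. For $i=1,\ldots,s$ define $B_i\in\mathbb{F}_q^{\mathbb{N}\times\mathbb{N}}$ by letting, for each $j\in\mathbb{N}$, the first $j$ entries of the $j$-th column be the coefficients (of $1,x,\ldots,x^{j-1}$) of $\mathfrak{b}_{j,i,j}$ modulo $x^j$ and all other entries of that column be $0$; and let $\Psi(\alpha_i)\in\mathbb{F}_q^{\mathbb{N}\times\mathbb{N}}$ be the infinite lower triangular Toeplitz matrix whose entry in row $r$ and column $c$ (indices starting at $1$) is $a_{i,r-c}$ if $r\ge c$ and $0$ otherwise. Then the matrices $C_i=(\Psi(\alpha_i)B_i)^\top$, $i=1,\ldots,s$, are generating matrices of a hyperplane sequence $\mathcal{S}_{\boldsymbol{\alpha}}$ associated with $\boldsymbol{\alpha}$.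
   Context: $\mathbb{F}_q$ is the finite field with $q$ elements. For $m\in\mathbb{N}$, $R_m=\mathbb{F}_q[x]/(x^m)$ (elements identified with polynomials of degree $<m$). For each $i=1,\ldots,s$ and $m\in\mathbb{N}$ an ordered basis $\mathfrak{B}_{m,i}=\{\mathfrak{b}_{m,i,1},\ldots,\mathfrak{b}_{m,i,m}\}$ of $R_m$ over $\mathbb{F}_q$ is fixed such that for $1\le j\le m$ the coefficient vector of $\mathfrak{b}_{m+1,i,j}$ w.r.t. $\{1,\ldots,x^m\}$ equals that of $\mathfrak{b}_{m,i,j}$ w.r.t. $\{1,\ldots,x^{m-1}\}$ with a $0$ appended. $\theta_m:R_m^s\to\mathbb{F}_q^{sm}$ sends $(k_1,\ldots,k_s)$ to the concatenation of the coordinate vectors of $k_i$ w.r.t. $\mathfrak{B}_{m,i}$. $Y=\{\alpha\in\mathbb{F}_q[[x]]:\gcd(\alpha\bmod x^m,x^m)=1\ \forall m\}$; for $\boldsymbol{\alpha}\in Y^s$, $\boldsymbol{\alpha}^{(m)}$ is the coordinatewise reduction mod $x^m$. $\mathcal{N}'_{\boldsymbol{\alpha}^{(m)}}=\{\mathbf{k}\in R_m^s:\sum_i\alpha^{(m)}_ik_i\equiv0\pmod{x^m}\}$, $\mathcal{N}_{\boldsymbol{\alpha}^{(m)}}=\theta_m(\mathcal{N}'_{\boldsymbol{\alpha}^{(m)}})$. For matrices $C_1,\ldots,C_s\in\mathbb{F}_q^{\mathbb{N}\times\mathbb{N}}$ let $C_i^{(m)}$ be the upper-left $m\times m$ submatrix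 of $C_i$ and $C^{(m)}=(C_1^{(m)\top}\cdots C_s^{(m)\top})\in\mathbb{F}_q^{m\times sm}$. The matrices $C_1,\ldots,C_s$ are generating matrices of a hyperplane sequence associated with $\boldsymbol{\alpha}$ if, for every $m\in\mathbb{N}$, the row space of $C^{(m)}$ equals the orthogonal complement of $\mathcal{N}_{\boldsymbol{\alpha}^{(m)}}$ in $\mathbb{F}_q^{sm}$ w.r.t. the standard inner product (the digital sequence they generate is then the hyperplane sequence). -}

module Defs where

open import Level using (0ℓ)
open import Data.Nat using (ℕ; zero; suc; _∸_; _≤_; _<_; _≤?_; _<?_; _^_)
open import Data.Nat.Primality using (Prime)
open import Data.Fin using (Fin; toℕ; fromℕ; fromℕ<; inject₁)
import Data.Fin as Fin
open import Data.Product using (Σ; ∃; _×_; _,_)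
open import Relation.Nullary using (¬_; yes; no)
open import Relation.Binary.PropositionalEquality using (_≡_)
open import Algebra.Structures using (IsCommutativeRing)
open import Function.Bundles using (_↔_; _⇔_)

IsPrimePower : ℕ → Set
IsPrimePower q = Σ ℕ λ p → Σ ℕ λ k → Prime p × 1 ≤ k × q ≡ p ^ k

record Field : Set₁ where
  infixl 6 _+_
  infixl 7 _*_
  field
    Carrier : Set
    _+_ _*_ : Carrier → Carrier → Carrier
    -_      : Carrier → Carrier
    0# 1#   : Carrier
    isCommutativeRing : IsCommutativeRing _≡_ _+_ _*_ -_ 0# 1#
    0≢1     : ¬ (0# ≡ 1#)
    inverse : ∀ x → ¬ (x ≡ 0#) → Σ Carrier λ y → x * y ≡ 1#

HasCard : Field → ℕ → Set
HasCard F q = Field.Carrier F ↔ Fin q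

module Hyperplane (F : Field) where
  open Field F

  sumℕ : ℕ → (ℕ → Carrier) → Carrier
  sumℕ zero    f = 0#
  sumℕ (suc n) f = sumℕ n f + f n

  sumFin : ∀ {n} → (Fin n → Carrier) → Carrier
  sumFin {zero}  f = 0#
  sumFin {suc n} f = f Fin.zero + sumFin (λ j → f (Fin.suc j))

  -- R_m = F[x]/(x^m): element = coefficient vector of 1, x, ..., x^(m-1)
  R : ℕ → Set
  R m = Fin m → Carrier

  ext : ∀ {m} → R m → ℕ → Carrier
  ext {m} f t with t <? m
  ... | yes p = f (fromℕ< p)
  ... | no _  = 0#

  mulR : ∀ {m} → R m → R m → R m
  mulR f g t = sumℕ (suc (toℕ t)) (λ u → ext f u * ext g (toℕ t ∸ u))

  PowerSeries : Set
  PowerSeries = ℕ → Carrier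

  reduce : (m : ℕ) → PowerSeries → R m
  reduce m α t = α (toℕ t)

  oneR : ∀ {m} → R m
  oneR t with toℕ t
  ... | zero  = 1#
  ... | suc _ = 0#

  -- gcd(f, x^m) = 1, expressed via the Bezout identity u·f + v·x^m = 1,
  -- i.e. ∃ u ∈ R_m with u·f ≡ 1 (mod x^m)
  CoprimeToXm : (m : ℕ) → R m → Set
  CoprimeToXm m f = Σ (R m) λ u → ∀ t → mulR u f t ≡ oneR t

  InY : PowerSeries → Set
  InY α = ∀ m → CoprimeToXm m (reduce m α)

  -- Families of ordered bases 𝔅_{m,i} = {𝔟_{m,i,1},…,𝔟_{m,i,m}} of R_m:
  -- 𝔟 m i j t = coefficient of x^t in 𝔟_{m,i,j+1}  (0-based j, t)
  BasisFamily : ℕ → Set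
  BasisFamily s = (m : ℕ) → Fin s → Fin m → R m

  lincomb : ∀ {m n} → (Fin n → R m) → (Fin n → Carrier) → R m
  lincomb b c t = sumFin (λ j → c j * b j t)

  IsBasis : ∀ {m} → (Fin m → R m) → Set
  IsBasis {m} b =
    (∀ (c : Fin m → Carrier) → (∀ t → lincomb b c t ≡ 0#) → ∀ j → c j ≡ 0#)
    × (∀ (v : R m) → Σ (Fin m → Carrier) λ c → ∀ t → v t ≡ lincomb b c t)

  ValidBases : ∀ {s} → BasisFamily s → Set
  ValidBases {s} 𝔟 =
    (∀ m i → IsBasis (𝔟 m i))
    × (∀ m i (j : Fin m) (t : Fin m) → 𝔟 (suc m) i (inject₁ j) (inject₁ t) ≡ 𝔟 m i j t)
    × (∀ m i (j : Fin m) → 𝔟 (suc m) i (inject₁ j) (fromℕ m) ≡ 0#)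

  IsCoords : ∀ {m} → (Fin m → R m) → R m → (Fin m → Carrier) → Set
  IsCoords b k c = ∀ t → k t ≡ lincomb b c t

  -- F_q^{sm}, indexed by (i, j) ↔ position (i-1)m + j of the concatenation
  Vecsm : ℕ → ℕ → Set
  Vecsm s m = Fin s → Fin m → Carrier

  Theta : ∀ {s m} → BasisFamily s → (Fin s → R m) → Vecsm s m → Set
  Theta {m = m} 𝔟 k v = ∀ i → IsCoords (𝔟 m i) (k i) (v i)

  InN' : ∀ {s} (m : ℕ) → (Fin s → PowerSeries) → (Fin s → R m) → Set
  InN' m α k = ∀ t → sumFin (λ i → mulR (reduce m (α i)) (k i) t) ≡ 0#

  InN : ∀ {s} → BasisFamily s → (m : ℕ) → (Fin s → PowerSeries) → Vecsm s m → Set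
  InN {s} 𝔟 m α v = Σ (Fin s → R m) λ k → InN' m α k × Theta 𝔟 k v

  inner : ∀ {s m} → Vecsm s m → Vecsm s m → Carrier
  inner v w = sumFin (λ i → sumFin (λ j → v i j * w i j))

  -- infinite matrices, 0-based: A r c = entry in row r+1, column c+1
  Mat : Set
  Mat = ℕ → ℕ → Carrier

  transpose : Mat → Mat
  transpose A r c = A c r

  -- row space of C^{(m)} = (C_1^{(m)⊤} ⋯ C_s^{(m)⊤}) ∈ F^{m × sm};
  -- row r of C^{(m)} at position (i, j) is (C_i^{(m)})_{j,r}
  InRowSpace : ∀ {s} (m : ℕ) → (Fin s → Mat) → Vecsm s m → Set
  InRowSpace {s} m C w =
    Σ (Fin m → Carrier) λ λ' → ∀ i j → w i j ≡ sumFin (λ r → λ' r * C i (toℕ j) (toℕ r))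

  InOrthN : ∀ {s} → BasisFamily s → (m : ℕ) → (Fin s → PowerSeries) → Vecsm s m → Set
  InOrthN 𝔟 m α w = ∀ v → InN 𝔟 m α v → inner w v ≡ 0#

  IsHyperplaneGen : ∀ {s} → BasisFamily s → (Fin s → PowerSeries) → (Fin s → Mat) → Set
  IsHyperplaneGen 𝔟 α C = ∀ m (w : Vecsm _ m) → InRowSpace m C w ⇔ InOrthN 𝔟 m α w

  -- B_i : column c (0-based; column j = c+1) has first j entries the coefficients
  -- of 𝔟_{j,i,j}, all other entries 0
  Bmat : ∀ {s} → BasisFamily s → Fin s → Mat
  Bmat 𝔟 i r c with r <? suc c
  ... | yes p = 𝔟 (suc c) i (fromℕ c) (fromℕ< p)
  ... | no _  = 0#

  Psi : PowerSeries → Mat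
  Psi a r c with c ≤? r
  ... | yes _ = a (r ∸ c)
  ... | no _  = 0#

  -- product A·B of infinite matrices with A lower triangular
  -- (A r k = 0 for k > r, so (A B)_{r,c} = Σ_{k ≤ r} A_{r,k} B_{k,c})
  mulLT : Mat → Mat → Mat
  mulLT A B r c = sumℕ (suc r) (λ k → A r k * B k c)

-- Column j of C_i, cut to its first m entries, is the coefficient vector of α_i 𝔟_{m,i,j} mod x^m
-- (the bases are compatible, so the columns of B_i restrict to the basis vectors of R_m). Hence w is
-- in the row space of C^{(m)} iff w_{i,j} = ℓ(α_i 𝔟_{m,i,j}) for a linear functional ℓ on R_m. Such a
-- w is orthogonal to θ_m(k), as the pairing equals ℓ(∑_i α_i k_i) = 0. Conversely, for w ⊥ 𝒩 put
-- φ_i(f) = ⟨w_i, coordinates of f⟩. Testing w against θ_m of k = ι_i f − ι_1 (α_1⁻¹ α_i f) ∈ 𝒩′, where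
-- ι_i puts its argument into slot i, gives φ_i(f) = φ_1(α_1⁻¹ α_i f), so ℓ = φ_1 ∘ (α_1⁻¹ ·) works.
module Submission where

open import Level using (0ℓ)
open import Data.Nat using (ℕ; zero; suc; _∸_; _≤_; _<_; _<?_; _≤?_; z≤n; s≤s)
open import Data.Nat.Properties
  using (≤-refl; ≤-pred; ≤-<-trans; m<n⇒m<1+n; m≤n⇒m≤1+n; n<1+n; m∸[m∸n]≡n; m∸n≤m; ≤-antisym; ≮⇒≥)
open import Data.Fin using (Fin; toℕ; fromℕ; fromℕ<; inject₁)
import Data.Fin as Fin
open import Data.Fin.Properties using (toℕ-injective; toℕ-fromℕ<; toℕ-fromℕ; toℕ-inject₁; toℕ<n; fromℕ<-toℕ)
open import Data.Fin.Relation.Unary.Top using (view; ‵fromℕ; ‵inject₁)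
open import Data.Product using (_,_; proj₁; proj₂)
open import Function.Base using (_∘_)
open import Function.Bundles using (mk⇔)
open import Relation.Nullary using (yes; no; contradiction)
open import Relation.Binary.PropositionalEquality using (_≡_; refl; sym; trans; cong; cong₂; module ≡-Reasoning)
open import Algebra.Bundles using (CommutativeRing)
open import Defs

module HyperplaneSequence (F : Field) where
  open Hyperplane F

  commutativeRing : CommutativeRing 0ℓ 0ℓ
  commutativeRing = record { isCommutativeRing = Field.isCommutativeRing F }

  open CommutativeRing commutativeRing hiding (refl; sym; trans)
  open import Algebra.Properties.Ring ring using (-1*x≈-x; x∙y⁻¹≈ε⇒x≈y)
  open import Algebra.Properties.Semiring.Sum semiring using (sum; sum-cong-≗; ∑-distrib-+; *-distribˡ-sum)
  open import Algebra.Properties.CommutativeSemigroup +-commutativeSemigroup using (interchange)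
  open import Algebra.Properties.CommutativeSemigroup *-commutativeSemigroup using (x∙yz≈y∙xz)
  open ≡-Reasoning

  sumFin≡sum : ∀ {n} (f : Fin n → Carrier) → sumFin f ≡ sum f
  sumFin≡sum {zero}  f = refl
  sumFin≡sum {suc n} f = cong (f Fin.zero +_) (sumFin≡sum (f ∘ Fin.suc))

  sumFin-cong : ∀ {n} {f g : Fin n → Carrier} → (∀ j → f j ≡ g j) → sumFin f ≡ sumFin g
  sumFin-cong {f = f} {g} f≗g rewrite sumFin≡sum f | sumFin≡sum g = sum-cong-≗ f≗g

  sumFin-distrib-+ : ∀ {n} (f g : Fin n → Carrier) → sumFin (λ j → f j + g j) ≡ sumFin f + sumFin g
  sumFin-distrib-+ f g rewrite sumFin≡sum (λ j → f j + g j) | sumFin≡sum f | sumFin≡sum g = ∑-distrib-+ f g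

  *-distribˡ-sumFin : ∀ {n} a (f : Fin n → Carrier) → a * sumFin f ≡ sumFin (λ j → a * f j)
  *-distribˡ-sumFin a f rewrite sumFin≡sum (λ j → a * f j) | sumFin≡sum f = *-distribˡ-sum a f

  dot : ∀ {n} → (Fin n → Carrier) → (Fin n → Carrier) → Carrier
  dot x y = sumFin (λ j → x j * y j)

  dot-comm : ∀ {n} (x y : Fin n → Carrier) → dot x y ≡ dot y x
  dot-comm x y = sumFin-cong (λ j → *-comm (x j) (y j))

  record IsLinear {I : Set} (L : (I → Carrier) → Carrier) : Set where
    field
      cong-≗ : ∀ {x y} → (∀ i → x i ≡ y i) → L x ≡ L y
      +-homo : ∀ x y → L (λ i → x i + y i) ≡ L x + L y
      *-homo : ∀ a x → L (λ i → a * x i) ≡ a * L x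

    0-homo : L (λ _ → 0#) ≡ 0#
    0-homo = begin
      L (λ _ → 0#)      ≡⟨ cong-≗ (λ _ → sym (zeroˡ 0#)) ⟩
      L (λ _ → 0# * 0#) ≡⟨ *-homo 0# (λ _ → 0#) ⟩
      0# * L (λ _ → 0#) ≡⟨ zeroˡ _ ⟩
      0#                ∎

    -‿homo : ∀ x → L (λ i → - x i) ≡ - L x
    -‿homo x = begin
      L (λ i → - x i)      ≡⟨ cong-≗ (λ i → sym (-1*x≈-x (x i))) ⟩
      L (λ i → - 1# * x i) ≡⟨ *-homo (- 1#) x ⟩
      - 1# * L x           ≡⟨ -1*x≈-x (L x) ⟩
      - L x                ∎

    combination-homo : ∀ a b x y → L (λ i → a * x i + b * y i) ≡ a * L x + b * L y
    combination-homo a b x y = trans (+-homo _ _) (cong₂ _+_ (*-homo a x) (*-homo b y))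

    sumFin-homo : ∀ {n} (x : Fin n → I → Carrier) → L (λ i → sumFin (λ k → x k i)) ≡ sumFin (λ k → L (x k))
    sumFin-homo {zero}  x = 0-homo
    sumFin-homo {suc n} x = trans (+-homo _ _) (cong (L (x Fin.zero) +_) (sumFin-homo (x ∘ Fin.suc)))

  open IsLinear

  IsLinearMap : {I J : Set} → ((I → Carrier) → J → Carrier) → Set
  IsLinearMap φ = ∀ j → IsLinear (λ x → φ x j)

  ∘-isLinear : {I J : Set} {L : (J → Carrier) → Carrier} {φ : (I → Carrier) → J → Carrier} →
               IsLinear L → IsLinearMap φ → IsLinear (L ∘ φ)
  ∘-isLinear L-lin φ-lin = record
    { cong-≗ = λ x≗y → cong-≗ L-lin (λ j → cong-≗ (φ-lin j) x≗y)
    ; +-homo = λ x y → trans (cong-≗ L-lin (λ j → +-homo (φ-lin j) x y)) (+-homo L-lin _ _)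
    ; *-homo = λ a x → trans (cong-≗ L-lin (λ j → *-homo (φ-lin j) a x)) (*-homo L-lin a _)
    }

  isLinear-resp-≗ : {I : Set} {L L′ : (I → Carrier) → Carrier} → (∀ x → L x ≡ L′ x) → IsLinear L → IsLinear L′
  isLinear-resp-≗ L≗L′ L-lin = record
    { cong-≗ = λ x≗y → trans (sym (L≗L′ _)) (trans (cong-≗ L-lin x≗y) (L≗L′ _))
    ; +-homo = λ x y → trans (sym (L≗L′ _)) (trans (+-homo L-lin x y) (cong₂ _+_ (L≗L′ x) (L≗L′ y)))
    ; *-homo = λ a x → trans (sym (L≗L′ _)) (trans (*-homo L-lin a x) (cong (a *_) (L≗L′ x)))
    }

  lincomb-homo : ∀ {m n} {L : R m → Carrier} → IsLinear L →
                 (b : Fin n → R m) (c : Fin n → Carrier) → L (lincomb b c) ≡ dot c (L ∘ b)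
  lincomb-homo {n = zero}  L-lin b c = 0-homo L-lin
  lincomb-homo {n = suc n} L-lin b c =
    trans (+-homo L-lin _ _) (cong₂ _+_ (*-homo L-lin _ _) (lincomb-homo L-lin (b ∘ Fin.suc) (c ∘ Fin.suc)))

  dot-isLinearʳ : ∀ {n} (x : Fin n → Carrier) → IsLinear (dot x)
  dot-isLinearʳ x = record
    { cong-≗ = λ y≗z → sumFin-cong (λ j → cong (x j *_) (y≗z j))
    ; +-homo = λ y z → trans (sumFin-cong (λ j → distribˡ (x j) (y j) (z j)))
                             (sumFin-distrib-+ (λ j → x j * y j) (λ j → x j * z j))
    ; *-homo = λ a y → trans (sumFin-cong (λ j → x∙yz≈y∙xz (x j) a (y j)))
                             (sym (*-distribˡ-sumFin a (λ j → x j * y j)))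
    }

  dot-isLinearˡ : ∀ {n} (y : Fin n → Carrier) → IsLinear (λ x → dot x y)
  dot-isLinearˡ y = isLinear-resp-≗ (λ x → dot-comm y x) (dot-isLinearʳ y)

  δ : ∀ {n} → Fin n → Fin n → Carrier
  δ Fin.zero    Fin.zero    = 1#
  δ Fin.zero    (Fin.suc _) = 0#
  δ (Fin.suc _) Fin.zero    = 0#
  δ (Fin.suc i) (Fin.suc j) = δ i j

  dot-δˡ : ∀ {n} (i : Fin n) (x : Fin n → Carrier) → dot (λ j → δ j i) x ≡ x i
  dot-δˡ Fin.zero    x = trans (cong₂ _+_ (*-identityˡ _) (0-homo (dot-isLinearˡ (x ∘ Fin.suc)))) (+-identityʳ _)
  dot-δˡ (Fin.suc i) x = trans (cong₂ _+_ (zeroˡ _) (dot-δˡ i (x ∘ Fin.suc))) (+-identityˡ _)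

  dot-δʳ : ∀ {n} (i : Fin n) (x : Fin n → Carrier) → dot x (λ j → δ j i) ≡ x i
  dot-δʳ i x = trans (dot-comm x _) (dot-δˡ i x)

  represent : ∀ {m} {L : R m → Carrier} → IsLinear L → ∀ f → L f ≡ dot (L ∘ δ) f
  represent {L = L} L-lin f = begin
    L f                 ≡⟨ cong-≗ L-lin (λ t → sym (dot-δʳ t f)) ⟩
    L (lincomb δ f)     ≡⟨ lincomb-homo L-lin δ f ⟩
    dot f (L ∘ δ)       ≡⟨ dot-comm f _ ⟩
    dot (L ∘ δ) f       ∎

  sumFin-δ-combination : ∀ {n} {I : Set} (L : Fin n → (I → Carrier) → Carrier) → (∀ k → IsLinear (L k)) →
    ∀ i j x y → sumFin (λ k → L k (λ t → δ k i * x t + δ k j * y t)) ≡ L i x + L j y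
  sumFin-δ-combination L L-lin i j x y = begin
    sumFin (λ k → L k (λ t → δ k i * x t + δ k j * y t))
      ≡⟨ sumFin-cong (λ k → combination-homo (L-lin k) _ _ x y) ⟩
    sumFin (λ k → δ k i * L k x + δ k j * L k y)
      ≡⟨ sumFin-distrib-+ (λ k → δ k i * L k x) (λ k → δ k j * L k y) ⟩
    dot (λ k → δ k i) (λ k → L k x) + dot (λ k → δ k j) (λ k → L k y)
      ≡⟨ cong₂ _+_ (dot-δˡ i _) (dot-δˡ j _) ⟩
    L i x + L j y ∎

  module Coordinates {m} {b : Fin m → R m} (basis : IsBasis b) where
    coords : R m → R m
    coords v = proj₁ (proj₂ basis v)

    coords-spec : ∀ v → IsCoords b v (coords v)
    coords-spec v = proj₂ (proj₂ basis v)

    lincomb-isLinear : ∀ t → IsLinear (λ c → lincomb b c t)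
    lincomb-isLinear t = dot-isLinearˡ (λ j → b j t)

    coords-unique : ∀ {v c} → IsCoords b v c → ∀ j → c j ≡ coords v j
    coords-unique {v} {c} v≡bc j = x∙y⁻¹≈ε⇒x≈y _ _ (proj₁ basis (λ k → c k - coords v k) difference-vanishes j)
      where
        difference-vanishes : ∀ t → lincomb b (λ k → c k - coords v k) t ≡ 0#
        difference-vanishes t = begin
          lincomb b (λ k → c k - coords v k) t              ≡⟨ +-homo (lincomb-isLinear t) c _ ⟩
          lincomb b c t + lincomb b (λ k → - coords v k) t  ≡⟨ cong (lincomb b c t +_) (-‿homo (lincomb-isLinear t) _) ⟩
          lincomb b c t - lincomb b (coords v) t            ≡⟨ cong₂ _-_ (sym (v≡bc t)) (sym (coords-spec v t)) ⟩
          v t - v t                                         ≡⟨ -‿inverseʳ (v t) ⟩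
          0#                                                ∎

    coords-isLinearMap : IsLinearMap coords
    coords-isLinearMap j = record
      { cong-≗ = λ {x} {y} x≗y → sym (coords-unique (λ t → trans (x≗y t) (coords-spec y t)) j)
      ; +-homo = λ x y → sym (coords-unique (λ t → trans (cong₂ _+_ (coords-spec x t) (coords-spec y t))
                                                     (sym (+-homo (lincomb-isLinear t) _ _))) j)
      ; *-homo = λ a x → sym (coords-unique (λ t → trans (cong (a *_) (coords-spec x t))
                                                     (sym (*-homo (lincomb-isLinear t) a _))) j)
      }

    coords-basis : ∀ k j → coords (b k) j ≡ δ j k
    coords-basis k j = sym (coords-unique (λ t → sym (dot-δˡ k (λ i → b i t))) j)

  sumℕ-cong : ∀ n {f g : ℕ → Carrier} → (∀ u → u < n → f u ≡ g u) → sumℕ n f ≡ sumℕ n g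
  sumℕ-cong zero    f≗g = refl
  sumℕ-cong (suc n) f≗g = cong₂ _+_ (sumℕ-cong n (λ u u<n → f≗g u (m<n⇒m<1+n u<n))) (f≗g n (n<1+n n))

  sumℕ-suc : ∀ n (f : ℕ → Carrier) → sumℕ (suc n) f ≡ f 0 + sumℕ n (f ∘ suc)
  sumℕ-suc zero    f = trans (+-identityˡ (f 0)) (sym (+-identityʳ (f 0)))
  sumℕ-suc (suc n) f = trans (cong (_+ f (suc n)) (sumℕ-suc n f)) (+-assoc _ _ _)

  sumℕ-reverse : ∀ n (f : ℕ → Carrier) → sumℕ (suc n) f ≡ sumℕ (suc n) (λ u → f (n ∸ u))
  sumℕ-reverse zero    f = refl
  sumℕ-reverse (suc n) f = begin
    sumℕ (suc n) f + f (suc n)                  ≡⟨ cong (_+ f (suc n)) (sumℕ-reverse n f) ⟩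
    sumℕ (suc n) (λ u → f (n ∸ u)) + f (suc n)  ≡⟨ +-comm _ _ ⟩
    f (suc n) + sumℕ (suc n) (λ u → f (n ∸ u))  ≡⟨ sym (sumℕ-suc (suc n) (λ u → f (suc n ∸ u))) ⟩
    sumℕ (suc (suc n)) (λ u → f (suc n ∸ u))    ∎

  conv : (ℕ → Carrier) → (ℕ → Carrier) → ℕ → Carrier
  conv f g zero    = f 0 * g 0
  conv f g (suc n) = f 0 * g (suc n) + conv (f ∘ suc) g n

  sumℕ≡conv : ∀ n (f g : ℕ → Carrier) → sumℕ (suc n) (λ u → f u * g (n ∸ u)) ≡ conv f g n
  sumℕ≡conv zero    f g = +-identityˡ _
  sumℕ≡conv (suc n) f g = trans (sumℕ-suc (suc n) _) (cong (f 0 * g (suc n) +_) (sumℕ≡conv n (f ∘ suc) g))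

  conv-comm : ∀ n (f g : ℕ → Carrier) → conv f g n ≡ conv g f n
  conv-comm n f g = begin
    conv f g n                                        ≡⟨ sym (sumℕ≡conv n f g) ⟩
    sumℕ (suc n) (λ u → f u * g (n ∸ u))              ≡⟨ sumℕ-reverse n _ ⟩
    sumℕ (suc n) (λ u → f (n ∸ u) * g (n ∸ (n ∸ u)))  ≡⟨ sumℕ-cong (suc n) swap ⟩
    sumℕ (suc n) (λ u → g u * f (n ∸ u))              ≡⟨ sumℕ≡conv n g f ⟩
    conv g f n                                        ∎
    where
      swap : ∀ u → u < suc n → f (n ∸ u) * g (n ∸ (n ∸ u)) ≡ g u * f (n ∸ u)
      swap u u<1+n = trans (cong (λ v → f (n ∸ u) * g v) (m∸[m∸n]≡n (≤-pred u<1+n))) (*-comm _ _)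

  conv-cong : ∀ n {f f′ g g′ : ℕ → Carrier} →
    (∀ u → u ≤ n → f u ≡ f′ u) → (∀ u → u ≤ n → g u ≡ g′ u) → conv f g n ≡ conv f′ g′ n
  conv-cong zero    f≗f′ g≗g′ = cong₂ _*_ (f≗f′ 0 z≤n) (g≗g′ 0 z≤n)
  conv-cong (suc n) f≗f′ g≗g′ = cong₂ _+_ (cong₂ _*_ (f≗f′ 0 z≤n) (g≗g′ (suc n) ≤-refl))
    (conv-cong n (λ u u≤n → f≗f′ (suc u) (s≤s u≤n)) (λ u u≤n → g≗g′ u (m≤n⇒m≤1+n u≤n)))

  conv-isLinearˡ : ∀ (g : ℕ → Carrier) n → IsLinear (λ f → conv f g n)
  conv-isLinearˡ g n = record
    { cong-≗ = λ f≗f′ → conv-cong n (λ u _ → f≗f′ u) (λ _ _ → refl)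
    ; +-homo = +-homo′ n
    ; *-homo = *-homo′ n
    }
    where
      +-homo′ : ∀ n f f′ → conv (λ u → f u + f′ u) g n ≡ conv f g n + conv f′ g n
      +-homo′ zero    f f′ = distribʳ _ _ _
      +-homo′ (suc n) f f′ = trans (cong₂ _+_ (distribʳ _ _ _) (+-homo′ n (f ∘ suc) (f′ ∘ suc))) (interchange _ _ _ _)
      *-homo′ : ∀ n a f → conv (λ u → a * f u) g n ≡ a * conv f g n
      *-homo′ zero    a f = *-assoc _ _ _
      *-homo′ (suc n) a f = trans (cong₂ _+_ (*-assoc _ _ _) (*-homo′ n a (f ∘ suc))) (sym (distribˡ _ _ _))

  conv-assoc : ∀ n (f g h : ℕ → Carrier) → conv f (conv g h) n ≡ conv (conv f g) h n
  conv-assoc zero    f g h = sym (*-assoc _ _ _)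
  conv-assoc (suc n) f g h = begin
    f 0 * (g 0 * h (suc n) + conv (g ∘ suc) h n) + conv (f ∘ suc) (conv g h) n
      ≡⟨ cong (_+ conv (f ∘ suc) (conv g h) n) (distribˡ _ _ _) ⟩
    (f 0 * (g 0 * h (suc n)) + f 0 * conv (g ∘ suc) h n) + conv (f ∘ suc) (conv g h) n
      ≡⟨ +-assoc _ _ _ ⟩
    f 0 * (g 0 * h (suc n)) + (f 0 * conv (g ∘ suc) h n + conv (f ∘ suc) (conv g h) n)
      ≡⟨ cong₂ _+_ (sym (*-assoc _ _ _))
                   (cong₂ _+_ (sym (*-homo (conv-isLinearˡ h n) (f 0) (g ∘ suc))) (conv-assoc n (f ∘ suc) g h)) ⟩
    (f 0 * g 0) * h (suc n) + (conv (λ u → f 0 * g (suc u)) h n + conv (conv (f ∘ suc) g) h n)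
      ≡⟨ cong ((f 0 * g 0) * h (suc n) +_) (sym (+-homo (conv-isLinearˡ h n) _ _)) ⟩
    (f 0 * g 0) * h (suc n) + conv (conv f g ∘ suc) h n ∎

  oneSeq : ℕ → Carrier
  oneSeq zero    = 1#
  oneSeq (suc _) = 0#

  conv-identityˡ : ∀ n (g : ℕ → Carrier) → conv oneSeq g n ≡ g n
  conv-identityˡ zero    g = *-identityˡ _
  conv-identityˡ (suc n) g =
    trans (cong₂ _+_ (*-identityˡ _) (0-homo (conv-isLinearˡ g n))) (+-identityʳ _)

  ext-lt : ∀ {m} (f : R m) x (x<m : x < m) → ext f x ≡ f (fromℕ< x<m)
  ext-lt {m} f x x<m with x <? m
  ... | yes _   = refl
  ... | no  x≮m = contradiction x<m x≮m

  ext-toℕ : ∀ {m} (f : R m) t → ext f (toℕ t) ≡ f t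
  ext-toℕ f t = trans (ext-lt f (toℕ t) (toℕ<n t)) (cong f (fromℕ<-toℕ t (toℕ<n t)))

  ext-isLinearMap : ∀ {m} → IsLinearMap (ext {m})
  ext-isLinearMap x = record
    { cong-≗ = λ f≗g → ext-cong f≗g x
    ; +-homo = λ f g → ext-+ f g x
    ; *-homo = λ a f → ext-* a f x
    }
    where
      ext-cong : ∀ {m} {f g : R m} → (∀ t → f t ≡ g t) → ∀ x → ext f x ≡ ext g x
      ext-cong {m} f≗g x with x <? m
      ... | yes x<m = f≗g (fromℕ< x<m)
      ... | no  _   = refl
      ext-+ : ∀ {m} (f g : R m) x → ext (λ t → f t + g t) x ≡ ext f x + ext g x
      ext-+ {m} f g x with x <? m
      ... | yes _ = refl
      ... | no  _ = sym (+-identityˡ 0#)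
      ext-* : ∀ {m} a (f : R m) x → ext (λ t → a * f t) x ≡ a * ext f x
      ext-* {m} a f x with x <? m
      ... | yes _ = refl
      ... | no  _ = sym (zeroʳ a)

  mulR≡conv : ∀ {m} (f g : R m) t → mulR f g t ≡ conv (ext f) (ext g) (toℕ t)
  mulR≡conv f g t = sumℕ≡conv (toℕ t) (ext f) (ext g)

  ext-mulR : ∀ {m} (f g : R m) x → x < m → ext (mulR f g) x ≡ conv (ext f) (ext g) x
  ext-mulR f g x x<m = begin
    ext (mulR f g) x                              ≡⟨ ext-lt (mulR f g) x x<m ⟩
    mulR f g (fromℕ< x<m)                         ≡⟨ mulR≡conv f g (fromℕ< x<m) ⟩
    conv (ext f) (ext g) (toℕ (fromℕ< x<m))       ≡⟨ cong (conv (ext f) (ext g)) (toℕ-fromℕ< x<m) ⟩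
    conv (ext f) (ext g) x                        ∎

  mulR-comm : ∀ {m} (f g : R m) t → mulR f g t ≡ mulR g f t
  mulR-comm f g t = trans (mulR≡conv f g t) (trans (conv-comm (toℕ t) _ _) (sym (mulR≡conv g f t)))

  mulR-isLinearMap : ∀ {m} (f : R m) → IsLinearMap (mulR f)
  mulR-isLinearMap f t = isLinear-resp-≗ (λ g → trans (conv-comm (toℕ t) _ _) (sym (mulR≡conv f g t)))
    (∘-isLinear (conv-isLinearˡ (ext f) (toℕ t)) ext-isLinearMap)

  mulR-congˡ : ∀ {m} {f f′ : R m} (g : R m) → (∀ t → f t ≡ f′ t) → ∀ t → mulR f g t ≡ mulR f′ g t
  mulR-congˡ {f = f} {f′} g f≗f′ t =
    trans (mulR-comm f g t) (trans (cong-≗ (mulR-isLinearMap g t) f≗f′) (mulR-comm g f′ t))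

  mulR-assoc : ∀ {m} (f g h : R m) t → mulR f (mulR g h) t ≡ mulR (mulR f g) h t
  mulR-assoc {m} f g h t = begin
    mulR f (mulR g h) t                          ≡⟨ mulR≡conv f _ t ⟩
    conv (ext f) (ext (mulR g h)) n              ≡⟨ conv-cong n (λ _ _ → refl) (λ u u≤n → ext-mulR g h u (below u≤n)) ⟩
    conv (ext f) (conv (ext g) (ext h)) n        ≡⟨ conv-assoc n _ _ _ ⟩
    conv (conv (ext f) (ext g)) (ext h) n        ≡⟨ conv-cong n (λ u u≤n → sym (ext-mulR f g u (below u≤n))) (λ _ _ → refl) ⟩
    conv (ext (mulR f g)) (ext h) n              ≡⟨ sym (mulR≡conv _ h t) ⟩
    mulR (mulR f g) h t                          ∎
    where
      n = toℕ t
      below : ∀ {u} → u ≤ n → u < m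
      below u≤n = ≤-<-trans u≤n (toℕ<n t)

  oneR≡oneSeq : ∀ {m} (t : Fin m) → oneR t ≡ oneSeq (toℕ t)
  oneR≡oneSeq t with toℕ t
  ... | zero  = refl
  ... | suc _ = refl

  mulR-identityˡ : ∀ {m} (h : R m) t → mulR oneR h t ≡ h t
  mulR-identityˡ {m} h t = begin
    mulR oneR h t                    ≡⟨ mulR≡conv oneR h t ⟩
    conv (ext (oneR {m})) (ext h) n  ≡⟨ conv-cong n ext-oneR (λ _ _ → refl) ⟩
    conv oneSeq (ext h) n            ≡⟨ conv-identityˡ n (ext h) ⟩
    ext h n                          ≡⟨ ext-toℕ h t ⟩
    h t                              ∎
    where
      n = toℕ t
      ext-oneR : ∀ u → u ≤ n → ext (oneR {m}) u ≡ oneSeq u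
      ext-oneR u u≤n = trans (ext-lt oneR u u<m) (trans (oneR≡oneSeq (fromℕ< u<m)) (cong oneSeq (toℕ-fromℕ< u<m)))
        where u<m = ≤-<-trans u≤n (toℕ<n t)

  mulR-cancel : ∀ {m} {u a : R m} → (∀ t → mulR u a t ≡ oneR t) → ∀ h t → mulR a (mulR u h) t ≡ h t
  mulR-cancel {u = u} {a} ua≡1 h t = begin
    mulR a (mulR u h) t   ≡⟨ mulR-assoc a u h t ⟩
    mulR (mulR a u) h t   ≡⟨ mulR-congˡ h (λ t′ → trans (mulR-comm a u t′) (ua≡1 t′)) t ⟩
    mulR oneR h t         ≡⟨ mulR-identityˡ h t ⟩
    h t                   ∎

  ext-reduce : ∀ m (a : PowerSeries) x → x < m → ext (reduce m a) x ≡ a x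
  ext-reduce m a x x<m = trans (ext-lt (reduce m a) x x<m) (cong a (toℕ-fromℕ< x<m))

  Psi-≤ : ∀ (a : PowerSeries) {r k} → k ≤ r → Psi a r k ≡ a (r ∸ k)
  Psi-≤ a {r} {k} k≤r with k ≤? r
  ... | yes _   = refl
  ... | no  k≰r = contradiction k≤r k≰r

  module Columns {s} {𝔟 : BasisFamily s} (valid : ValidBases 𝔟) where

    ext-inject₁ : ∀ n i (j : Fin n) x → ext (𝔟 (suc n) i (inject₁ j)) x ≡ ext (𝔟 n i j) x
    ext-inject₁ n i j x with x <? suc n | x <? n
    ... | yes x<1+n | yes x<n = trans (cong (𝔟 (suc n) i (inject₁ j)) index) (proj₁ (proj₂ valid) n i j _)
      where
        index : fromℕ< x<1+n ≡ inject₁ (fromℕ< x<n)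
        index = toℕ-injective (trans (toℕ-fromℕ< x<1+n) (sym (trans (toℕ-inject₁ _) (toℕ-fromℕ< x<n))))
    ... | yes x<1+n | no  x≮n = trans (cong (𝔟 (suc n) i (inject₁ j)) index) (proj₂ (proj₂ valid) n i j)
      where
        index : fromℕ< x<1+n ≡ fromℕ n
        index = toℕ-injective (trans (toℕ-fromℕ< x<1+n)
                  (trans (≤-antisym (≤-pred x<1+n) (≮⇒≥ x≮n)) (sym (toℕ-fromℕ n))))
    ... | no  x≮1+n | yes x<n = contradiction (m<n⇒m<1+n x<n) x≮1+n
    ... | no  _     | no  _   = refl

    Bmat-last : ∀ n i x → Bmat 𝔟 i x n ≡ ext (𝔟 (suc n) i (fromℕ n)) x
    Bmat-last n i x with x <? suc n
    ... | yes _ = refl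
    ... | no  _ = refl

    Bmat-column : ∀ m i (j : Fin m) x → Bmat 𝔟 i x (toℕ j) ≡ ext (𝔟 m i j) x
    Bmat-column (suc n) i j x with view j
    ... | ‵fromℕ rewrite toℕ-fromℕ n = Bmat-last n i x
    ... | ‵inject₁ j′ rewrite toℕ-inject₁ j′ = trans (Bmat-column n i j′ x) (sym (ext-inject₁ n i j′ x))

    generator-entry : ∀ a m i (j r : Fin m) →
      transpose (mulLT (Psi a) (Bmat 𝔟 i)) (toℕ j) (toℕ r) ≡ mulR (reduce m a) (𝔟 m i j) r
    generator-entry a m i j r = trans (sumℕ-cong (suc (toℕ r)) term) (mulR-comm (𝔟 m i j) (reduce m a) r)
      where
        term : ∀ k → k < suc (toℕ r) →
               Psi a (toℕ r) k * Bmat 𝔟 i k (toℕ j) ≡ ext (𝔟 m i j) k * ext (reduce m a) (toℕ r ∸ k)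
        term k k<1+r = trans (*-comm _ _) (cong₂ _*_ (Bmat-column m i j k)
          (trans (Psi-≤ a (≤-pred k<1+r)) (sym (ext-reduce m a _ (≤-<-trans (m∸n≤m (toℕ r) k) (toℕ<n r))))))

  module Generating {s} {𝔟 : BasisFamily (suc s)} (valid : ValidBases 𝔟) (α : Fin (suc s) → PowerSeries) where
    open Columns valid

    C : Fin (suc s) → Mat
    C i = transpose (mulLT (Psi (α i)) (Bmat 𝔟 i))

    mulα : ∀ {m} → Fin (suc s) → R m → R m
    mulα {m} i = mulR (reduce m (α i))

    row-entry : ∀ m (λ′ : Fin m → Carrier) i j → dot λ′ (λ r → C i (toℕ j) (toℕ r)) ≡ dot λ′ (mulα i (𝔟 m i j))
    row-entry m λ′ i j = cong-≗ (dot-isLinearʳ λ′) (generator-entry (α i) m i j)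

    rowSpace⊆orthogonal : ∀ m w → InRowSpace m C w → InOrthN 𝔟 m α w
    rowSpace⊆orthogonal m w (λ′ , w≡) v (k , k∈N′ , k≡bv) = begin
      inner w v                                     ≡⟨ sumFin-cong slot ⟩
      sumFin (λ i → L i (k i))                      ≡⟨ sym (sumFin-homo (dot-isLinearʳ λ′) (λ i → mulα i (k i))) ⟩
      dot λ′ (λ r → sumFin (λ i → mulα i (k i) r))  ≡⟨ cong-≗ (dot-isLinearʳ λ′) k∈N′ ⟩
      dot λ′ (λ _ → 0#)                             ≡⟨ 0-homo (dot-isLinearʳ λ′) ⟩
      0#                                            ∎
      where
        L : Fin (suc s) → R m → Carrier
        L i = dot λ′ ∘ mulα i
        L-isLinear : ∀ i → IsLinear (L i)
        L-isLinear i = ∘-isLinear (dot-isLinearʳ λ′) (mulR-isLinearMap (reduce m (α i)))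
        slot : ∀ i → dot (w i) (v i) ≡ L i (k i)
        slot i = begin
          dot (w i) (v i)             ≡⟨ dot-comm (w i) (v i) ⟩
          dot (v i) (w i)             ≡⟨ cong-≗ (dot-isLinearʳ (v i)) (λ j → trans (w≡ i j) (row-entry m λ′ i j)) ⟩
          dot (v i) (L i ∘ 𝔟 m i)     ≡⟨ sym (lincomb-homo (L-isLinear i) (𝔟 m i) (v i)) ⟩
          L i (lincomb (𝔟 m i) (v i)) ≡⟨ cong-≗ (L-isLinear i) (λ t → sym (k≡bv i t)) ⟩
          L i (k i)                   ∎

    module _ (m : ℕ) (w : Vecsm (suc s) m) (w⊥𝒩 : InOrthN 𝔟 m α w)
             {u : R m} (u-inverse : ∀ t → mulR u (reduce m (α Fin.zero)) t ≡ oneR t) where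
      open module Coordinatesᵢ i = Coordinates (proj₁ valid m i)

      φ : Fin (suc s) → R m → Carrier
      φ i = dot (w i) ∘ coords i

      φ-isLinear : ∀ i → IsLinear (φ i)
      φ-isLinear i = ∘-isLinear (dot-isLinearʳ (w i)) (coords-isLinearMap i)

      φ-basis : ∀ i j → φ i (𝔟 m i j) ≡ w i j
      φ-basis i j = trans (cong-≗ (dot-isLinearʳ (w i)) (coords-basis i j)) (dot-δʳ j (w i))

      φ-vanishes : ∀ k → InN' m α k → sumFin (λ i → φ i (k i)) ≡ 0#
      φ-vanishes k k∈N′ = w⊥𝒩 _ (k , k∈N′ , λ i → coords-spec i (k i))

      φ-transfer : ∀ i f → φ i f ≡ φ Fin.zero (mulR u (mulα i f))
      φ-transfer i f = x∙y⁻¹≈ε⇒x≈y _ _ (begin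
        φ i f - φ Fin.zero (mulR u h)  ≡⟨ cong (φ i f +_) (sym (-‿homo (φ-isLinear Fin.zero) _)) ⟩
        φ i f + φ Fin.zero g           ≡⟨ sym (sumFin-δ-combination φ φ-isLinear i Fin.zero f g) ⟩
        sumFin (λ k → φ k (test k))    ≡⟨ φ-vanishes test test∈N′ ⟩
        0#                             ∎)
        where
          h g : R m
          h = mulα i f
          g t = - mulR u h t
          -- ι_i f − ι_1 (u α_i f), which lies in 𝒩′ since α_1 u ≡ 1 mod x^m
          test : Fin (suc s) → R m
          test k t = δ k i * f t + δ k Fin.zero * g t
          test∈N′ : InN' m α test
          test∈N′ t = begin
            sumFin (λ k → mulα k (test k) t)
              ≡⟨ sumFin-δ-combination (λ k x → mulα k x t) (λ k → mulR-isLinearMap _ t) i Fin.zero f g ⟩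
            h t + mulα Fin.zero g t
              ≡⟨ cong (h t +_) (-‿homo (mulR-isLinearMap _ t) _) ⟩
            h t - mulα Fin.zero (mulR u h) t
              ≡⟨ cong (λ y → h t - y) (mulR-cancel u-inverse h t) ⟩
            h t - h t
              ≡⟨ -‿inverseʳ (h t) ⟩
            0# ∎

      ℓ : R m → Carrier
      ℓ = φ Fin.zero ∘ mulR u

      orthogonal⊆rowSpace : InRowSpace m C w
      orthogonal⊆rowSpace = ℓ ∘ δ , λ i j → begin
        w i j                                    ≡⟨ sym (φ-basis i j) ⟩
        φ i (𝔟 m i j)                            ≡⟨ φ-transfer i _ ⟩
        ℓ (mulα i (𝔟 m i j))                     ≡⟨ represent (∘-isLinear (φ-isLinear Fin.zero) (mulR-isLinearMap u)) _ ⟩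
        dot (ℓ ∘ δ) (mulα i (𝔟 m i j))           ≡⟨ sym (row-entry m (ℓ ∘ δ) i j) ⟩
        dot (ℓ ∘ δ) (λ r → C i (toℕ j) (toℕ r))  ∎

    isHyperplaneGen : (∀ i → InY (α i)) → IsHyperplaneGen 𝔟 α C
    isHyperplaneGen α∈Y m w =
      mk⇔ (rowSpace⊆orthogonal m w) (λ w⊥𝒩 → orthogonal⊆rowSpace m w w⊥𝒩 (proj₂ (α∈Y Fin.zero m)))

-- Neither q nor the cardinality of F plays a role: the argument works over any field.
theorem8 : (q : ℕ) → IsPrimePower q → (F : Field) → HasCard F q →
    (s : ℕ) → 2 ≤ s →
    (𝔟 : Hyperplane.BasisFamily F s) → Hyperplane.ValidBases F 𝔟 →
    (α : Fin s → Hyperplane.PowerSeries F) → (∀ i → Hyperplane.InY F (α i)) →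
    Hyperplane.IsHyperplaneGen F 𝔟 α
      (λ i → Hyperplane.transpose F
               (Hyperplane.mulLT F (Hyperplane.Psi F (α i)) (Hyperplane.Bmat F 𝔟 i)))
theorem8 _ _ F _ (suc s) _ 𝔟 valid α α∈Y = HyperplaneSequence.Generating.isHyperplaneGen F valid α α∈Y
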